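{- Let $p$ be a prime and $k\in\mathbb{Z}$. For all $a,b\in\mathbb{Z}[\tfrac1p]$ with $a>0$, there exist unique $q,r\in\mathbb{Z}[\tfrac1p]$ such that $$b=aq-r,\qquad 0\le r<ap^k,\qquad |r|_p\le |ap^k|_p.$$
   Context: $|\cdot|_p$ is the $p$-adic absolute value: $|0|_p=0$ and $|\tfrac{u}{v}p^\nu|_p=p^{ -\nu}$ when $p\nmid uv$. The inequalities $0\le r<ap^k$ are in the usual order of $\mathbb{R}$. -}

module Defs where

open import Data.Nat as ℕ using (ℕ; suc; _^_; NonZero)
open import Data.Nat.Properties using (m^n≢0)
open import Data.Nat.Divisibility using (_∣_)
open import Data.Nat.Primality using (Prime; prime⇒nonZero)
open import Data.Integer as ℤ using (ℤ; +_; -[1+_]; ∣_∣)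
open import Data.Rational using (ℚ; _/_; _*_; _-_; 0ℚ; _≤_; _<_)
open import Data.Product using (Σ; _×_)
open import Data.Sum using (_⊎_)
open import Relation.Binary.PropositionalEquality using (_≡_)
open import Relation.Nullary using (¬_)

ℕ→ℚ : ℕ → ℚ
ℕ→ℚ n = (+ n) / 1

pPow : (p : ℕ) → Prime p → ℤ → ℚ
pPow p pr (+ n)    = (+ (p ^ n)) / 1
pPow p pr -[1+ n ] = (+ 1) / (p ^ suc n)
  where instance
    _ : NonZero p
    _ = prime⇒nonZero pr
    _ : NonZero (p ^ suc n)
    _ = m^n≢0 p (suc n)

InZ1/p : ℕ → ℚ → Set
InZ1/p p x = Σ ℕ λ n → Σ ℤ λ m → x * ℕ→ℚ (p ^ n) ≡ (m / 1)

-- PAbs p pr x v  means  |x|_p = v, exactly as in the definition: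
-- |0|_p = 0 and |(u/w) p^ν|_p = p^(-ν) when p ∤ u w.
PAbs : (p : ℕ) → Prime p → ℚ → ℚ → Set
PAbs p pr x v =
  (x ≡ 0ℚ × v ≡ 0ℚ)
  ⊎ Σ ℤ λ u → Σ ℕ λ w' → Σ ℤ λ ν →
      ¬ (p ∣ ∣ u ∣) × ¬ (p ∣ suc w')
      × x ≡ (u / suc w') * pPow p pr ν
      × v ≡ pPow p pr (ℤ.- ν)

PAbsLe : (p : ℕ) → Prime p → ℚ → ℚ → Set
PAbsLe p pr x y = Σ ℚ λ vx → Σ ℚ λ vy → PAbs p pr x vx × PAbs p pr y vy × vx ≤ vy

DivCond : (p : ℕ) → Prime p → ℤ → (a b q r : ℚ) → Set
DivCond p pr k a b q r =
  b ≡ a * q - r × 0ℚ ≤ r × r < a * pPow p pr k × PAbsLe p pr r (a * pPow p pr k)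

module Submission where

-- A positive a ∈ Z[1/p] has a p-normal form a·p^k = t·p^σ with t a
-- positive natural number prime to p, and then |a·p^k|_p = p^(-σ).  Within
-- Z[1/p] the admissible remainders are exactly r = ρ·p^σ with 0 ≤ ρ < t, and
-- b = a·q - r then says b·p^(-σ) + ρ ∈ t·Z[1/p], i.e. ρ is the residue of
-- -b·p^(-σ) modulo t; as p ∤ t, Z[1/p]/tZ[1/p] ≅ ℤ/tℤ.  Existence of the
-- residue comes from Bézout (p^n is invertible modulo t), uniqueness from
-- integrality: x ∈ Z[1/p] with x·t ∈ ℤ and p ∤ t is an integer.

open import Defs

open import Data.Nat as ℕ using (ℕ; zero; suc; _^_)
import Data.Nat.Properties as ℕP
open import Data.Nat.Primality using (Prime; prime⇒nonZero; prime⇒nonTrivial; prime⇒irreducible; euclidsLemma)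
open import Data.Integer as ℤ using (ℤ; +_; -[1+_]; +0; +[1+_])
import Data.Integer.Properties as ℤP
import Data.Integer.DivMod as ℤDM
import Data.Nat.Coprimality as ℕC
import Data.Nat.GCD as ℕG
open import Data.Nat.Induction using (<-rec)
open import Data.Rational
open import Data.Rational.Properties
import Data.Rational.Unnormalised as ℚᵘ
import Data.Rational.Unnormalised.Properties as ℚᵘP
import Data.Rational.Solver as ℚSolver
import Data.Integer.Solver as ℤSolver
open import Data.Product using (Σ; _,_; _×_; proj₁; proj₂)
open import Data.Sum using (inj₁; inj₂; [_,_]′)
open import Data.Empty using (⊥-elim)
import Data.Nat.Divisibility as ℕD
import Data.Integer.Divisibility.Signed as ℤD
import Data.Integer.Coprimality as ℤC
open import Relation.Nullary using (¬_; yes; no)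
open import Relation.Binary.PropositionalEquality
open import Relation.Binary.Definitions using (tri<; tri≈; tri>)

ι : ℤ → ℚ
ι m = m / 1

module _ where
  private
    1-coprime : ∀ n → ℕC.Coprime n 1
    1-coprime n = ℕC.sym (ℕC.1-coprimeTo n)

    -- ι m in normal form, so that ℚ operations on it compute.
    ι-normal : ∀ m → ι m ≡ mkℚ m 0 (1-coprime ℤ.∣ m ∣)
    ι-normal m = ↥p/↧p≡p (mkℚ m 0 (1-coprime ℤ.∣ m ∣))

  ι-* : ∀ m n → ι (m ℤ.* n) ≡ ι m * ι n
  ι-* m n rewrite ι-normal m | ι-normal n = refl

  ι-+ : ∀ m n → ι (m ℤ.+ n) ≡ ι m + ι n
  ι-+ m n rewrite ι-normal m | ι-normal n | ℤP.*-identityʳ m | ℤP.*-identityʳ n = refl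

  ι-neg : ∀ m → ι (ℤ.- m) ≡ - ι m
  ι-neg m rewrite ι-normal m | ι-normal (ℤ.- m) = neg-normal m
    where
    neg-normal : ∀ m → mkℚ (ℤ.- m) 0 (1-coprime ℤ.∣ ℤ.- m ∣) ≡ - mkℚ m 0 (1-coprime ℤ.∣ m ∣)
    neg-normal (+ zero) = refl
    neg-normal +[1+ n ] = refl
    neg-normal -[1+ n ] = refl

  ι-≤ : ∀ {m n} → m ℤ.≤ n → ι m ≤ ι n
  ι-≤ {m} {n} m≤n rewrite ι-normal m | ι-normal n =
    *≤* (subst₂ ℤ._≤_ (sym (ℤP.*-identityʳ m)) (sym (ℤP.*-identityʳ n)) m≤n)

  ι-≤⁻ : ∀ {m n} → ι m ≤ ι n → m ℤ.≤ n
  ι-≤⁻ {m} {n} ιm≤ιn rewrite ι-normal m | ι-normal n with ιm≤ιn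
  ... | *≤* m≤n = subst₂ ℤ._≤_ (ℤP.*-identityʳ m) (ℤP.*-identityʳ n) m≤n

  ι-< : ∀ {m n} → m ℤ.< n → ι m < ι n
  ι-< {m} {n} m<n rewrite ι-normal m | ι-normal n =
    *<* (subst₂ ℤ._<_ (sym (ℤP.*-identityʳ m)) (sym (ℤP.*-identityʳ n)) m<n)

  ι-<⁻ : ∀ {m n} → ι m < ι n → m ℤ.< n
  ι-<⁻ {m} {n} ιm<ιn rewrite ι-normal m | ι-normal n with ιm<ιn
  ... | *<* m<n = subst₂ ℤ._<_ (ℤP.*-identityʳ m) (ℤP.*-identityʳ n) m<n

  ι-injective : ∀ {m n} → ι m ≡ ι n → m ≡ n
  ι-injective eq = ℤP.≤-antisym (ι-≤⁻ (≤-reflexive eq)) (ι-≤⁻ (≤-reflexive (sym eq)))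

/-*-denominator : ∀ (u : ℤ) d .{{_ : ℕ.NonZero d}} → (u / d) * ι (+ d) ≡ ι u
/-*-denominator u (suc d) = toℚᵘ-injective (begin
    toℚᵘ ((u / suc d) * ι (+ suc d))         ≈⟨ toℚᵘ-homo-* (u / suc d) (ι (+ suc d)) ⟩
    toℚᵘ (u / suc d) ℚᵘ.* toℚᵘ (ι (+ suc d)) ≈⟨ ℚᵘP.*-cong (toℚᵘ-fromℚᵘ (ℚᵘ.mkℚᵘ u d)) (toℚᵘ-fromℚᵘ (ℚᵘ.mkℚᵘ (+ suc d) 0)) ⟩
    ℚᵘ.mkℚᵘ u d ℚᵘ.* ℚᵘ.mkℚᵘ (+ suc d) 0     ≈⟨ ℚᵘ.*≡* cross ⟩
    ℚᵘ.mkℚᵘ u 0                              ≈⟨ ℚᵘP.≃-sym (toℚᵘ-fromℚᵘ (ℚᵘ.mkℚᵘ u 0)) ⟩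
    toℚᵘ (ι u) ∎)
  where
  open ℚᵘP.≃-Reasoning
  cross : (u ℤ.* + suc d) ℤ.* + 1 ≡ u ℤ.* (+ (suc d ℕ.* 1))
  cross rewrite ℕP.*-identityʳ (suc d) | ℤP.*-identityʳ (u ℤ.* + suc d) = refl

*-cancelʳ-pos : ∀ {x y} c → 0ℚ < c → x * c ≡ y * c → x ≡ y
*-cancelʳ-pos {x} {y} c c>0 eq = begin
    x                ≡⟨ sym (*-identityʳ x) ⟩
    x * 1ℚ           ≡⟨ cong (x *_) (sym (*-inverseʳ c)) ⟩
    x * (c * 1/ c)   ≡⟨ sym (*-assoc x c (1/ c)) ⟩
    (x * c) * 1/ c   ≡⟨ cong (_* 1/ c) eq ⟩
    (y * c) * 1/ c   ≡⟨ *-assoc y c (1/ c) ⟩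
    y * (c * 1/ c)   ≡⟨ cong (y *_) (*-inverseʳ c) ⟩
    y * 1ℚ           ≡⟨ *-identityʳ y ⟩
    y ∎
  where
  open ≡-Reasoning
  instance _ = >-nonZero c>0

module _ where
  open ℚSolver.+-*-Solver
  open ≡-Reasoning

  remainder-difference : ∀ {a b q₁ r₁ q₂ r₂} → b ≡ a * q₁ - r₁ → b ≡ a * q₂ - r₂ → a * (q₁ - q₂) ≡ r₁ - r₂
  remainder-difference {a} {b} {q₁} {r₁} {q₂} {r₂} b≡aq₁-r₁ b≡aq₂-r₂ = begin
      a * (q₁ - q₂)                                 ≡⟨ solve 5 (λ a q₁ q₂ r₁ r₂ → a :* (q₁ :- q₂) := ((a :* q₁ :- r₁) :- (a :* q₂ :- r₂)) :+ (r₁ :- r₂)) refl a q₁ q₂ r₁ r₂ ⟩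
      ((a * q₁ - r₁) - (a * q₂ - r₂)) + (r₁ - r₂)   ≡⟨ cong₂ (λ u v → (u - v) + (r₁ - r₂)) b≡aq₁-r₁ b≡aq₂-r₂ ⟨
      (b - b) + (r₁ - r₂)                           ≡⟨ solve 3 (λ b r₁ r₂ → (b :- b) :+ (r₁ :- r₂) := r₁ :- r₂) refl b r₁ r₂ ⟩
      r₁ - r₂ ∎

  quotient-determined : ∀ {a b q₁ r₁ q₂ r₂} → 0ℚ < a → b ≡ a * q₁ - r₁ → b ≡ a * q₂ - r₂ → r₁ ≡ r₂ → q₁ ≡ q₂
  quotient-determined {a} {b} {q₁} {r₁} {q₂} {r₂} 0<a b≡aq₁-r₁ b≡aq₂-r₂ r₁≡r₂ = *-cancelʳ-pos {q₁} {q₂} a 0<a (begin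
      q₁ * a               ≡⟨ solve 3 (λ a q r → q :* a := (a :* q :- r) :+ r) refl a q₁ r₁ ⟩
      (a * q₁ - r₁) + r₁   ≡⟨ cong₂ _+_ b≡aq₁-r₁ (sym r₁≡r₂) ⟨
      b + r₂               ≡⟨ cong (_+ r₂) b≡aq₂-r₂ ⟩
      (a * q₂ - r₂) + r₂   ≡⟨ solve 3 (λ a q r → (a :* q :- r) :+ r := q :* a) refl a q₂ r₂ ⟩
      q₂ * a ∎)

module _ where
  open ℤSolver.+-*-Solver
  open ≡-Reasoning

  ≤-gap : ∀ {i j} → i ℤ.≤ j → Σ ℕ λ d → j ≡ i ℤ.+ + d
  ≤-gap {i} {j} i≤j = ℤ.∣ j ℤ.- i ∣ , (begin
      j                   ≡⟨ solve 2 (λ i j → j := i :+ (j :- i)) refl i j ⟩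
      i ℤ.+ (j ℤ.- i)     ≡⟨ cong (λ z → i ℤ.+ z) (sym (ℤP.0≤i⇒+∣i∣≡i (ℤP.i≤j⇒0≤j-i i≤j))) ⟩
      i ℤ.+ + ℤ.∣ j ℤ.- i ∣ ∎)

  -i+[i+j]≡j : ∀ i j → ℤ.- i ℤ.+ (i ℤ.+ j) ≡ j
  -i+[i+j]≡j = solve 2 (λ i j → :- i :+ (i :+ j) := j) refl

  -i+j+i≡j : ∀ i j → (ℤ.- i ℤ.+ j) ℤ.+ i ≡ j
  -i+j+i≡j = solve 2 (λ i j → (:- i :+ j) :+ i := j) refl

  +-interchange : ∀ a b c d → (a ℤ.+ b) ℤ.+ (c ℤ.+ d) ≡ (a ℤ.+ c) ℤ.+ (b ℤ.+ d)
  +-interchange = solve 4 (λ a b c d → (a :+ b) :+ (c :+ d) := (a :+ c) :+ (b :+ d)) refl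

  <-gap : ∀ {i j} → i ℤ.< j → Σ ℕ λ d → j ≡ i ℤ.+ + suc d
  <-gap {i} {j} i<j with ≤-gap (ℤP.i<j⇒suc[i]≤j i<j)
  ... | d , j≡ = d , trans j≡ (solve 2 (λ i d → (con (+ 1) :+ i) :+ d := i :+ (con (+ 1) :+ d)) refl i (+ d))

  bezout : ∀ P t → ℕC.Coprime P t → Σ ℤ λ X → Σ ℤ λ Y → + P ℤ.* X ≡ + 1 ℤ.+ + t ℤ.* Y
  bezout P t P⊥t with ℕC.coprime-Bézout P⊥t
  ... | ℕG.Bézout.+- x y eq = + x , + y , (begin
      + P ℤ.* + x                ≡⟨ solve 2 (λ P x → P :* x := x :* P) refl (+ P) (+ x) ⟩
      + x ℤ.* + P                ≡⟨ lift-identity eq ⟨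
      + 1 ℤ.+ + y ℤ.* + t        ≡⟨ solve 2 (λ y t → con (+ 1) :+ y :* t := con (+ 1) :+ t :* y) refl (+ y) (+ t) ⟩
      + 1 ℤ.+ + t ℤ.* + y ∎)
    where
    lift-identity : 1 ℕ.+ y ℕ.* t ≡ x ℕ.* P → + 1 ℤ.+ + y ℤ.* + t ≡ + x ℤ.* + P
    lift-identity e = trans (cong (λ z → + 1 ℤ.+ z) (sym (ℤP.pos-* y t)))
                      (trans (sym (ℤP.pos-+ 1 (y ℕ.* t))) (trans (cong +_ e) (ℤP.pos-* x P)))
  ... | ℕG.Bézout.-+ x y eq = ℤ.- + x , ℤ.- + y , (begin
      + P ℤ.* ℤ.- + x                   ≡⟨ solve 2 (λ P x → P :* (:- x) := con (+ 1) :- (con (+ 1) :+ x :* P)) refl (+ P) (+ x) ⟩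
      + 1 ℤ.- (+ 1 ℤ.+ + x ℤ.* + P)     ≡⟨ cong (λ z → + 1 ℤ.- z) (lift-identity eq) ⟩
      + 1 ℤ.- + y ℤ.* + t               ≡⟨ solve 2 (λ y t → con (+ 1) :- y :* t := con (+ 1) :+ t :* (:- y)) refl (+ y) (+ t) ⟩
      + 1 ℤ.+ + t ℤ.* ℤ.- + y ∎)
    where
    lift-identity : 1 ℕ.+ x ℕ.* P ≡ y ℕ.* t → + 1 ℤ.+ + x ℤ.* + P ≡ + y ℤ.* + t
    lift-identity e = trans (cong (λ z → + 1 ℤ.+ z) (sym (ℤP.pos-* x P)))
                      (trans (sym (ℤP.pos-+ 1 (x ℕ.* P))) (trans (cong +_ e) (ℤP.pos-* y t)))

congruent-below-equal : ∀ ρ₁ ρ₂ t c → ρ₁ ℕ.< t → ρ₂ ℕ.< t → + ρ₁ ℤ.- + ρ₂ ≡ c ℤ.* + t → ρ₁ ≡ ρ₂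
congruent-below-equal ρ₁ ρ₂ t c ρ₁<t ρ₂<t eq =
    by-multiple ℤ.∣ c ∣ (trans (cong ℤ.∣_∣ eq) (ℤP.abs-* c (+ t)))
  where
  |diff|<t : ℤ.∣ + ρ₁ ℤ.- + ρ₂ ∣ ℕ.< t
  |diff|<t = ℕP.≤-<-trans
    (subst (ℕ._≤ ρ₁ ℕ.⊔ ρ₂) (cong ℤ.∣_∣ (sym (ℤP.[+m]-[+n]≡m⊖n ρ₁ ρ₂))) (ℤP.∣m⊝n∣≤m⊔n ρ₁ ρ₂))
    (ℕP.⊔-lub ρ₁<t ρ₂<t)
  by-multiple : ∀ n → ℤ.∣ + ρ₁ ℤ.- + ρ₂ ∣ ≡ n ℕ.* t → ρ₁ ≡ ρ₂
  by-multiple zero    |diff|≡0 = ℤP.+-injective (ℤP.i-j≡0⇒i≡j (+ ρ₁) (+ ρ₂) (ℤP.∣i∣≡0⇒i≡0 |diff|≡0))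
  by-multiple (suc n) |diff|≡  = ⊥-elim (ℕP.<⇒≱ |diff|<t
    (ℕP.≤-trans (ℕP.m≤m+n t (n ℕ.* t)) (ℕP.≤-reflexive (sym |diff|≡))))

module _ (p : ℕ) (pr : Prime p) where
  private instance p≢0 = prime⇒nonZero pr
  open ℚSolver.+-*-Solver

  -- p^e ∈ ℚ for e ∈ ℤ; on naturals, P (+ n) is definitionally ι (+ (p ^ n)).
  P : ℤ → ℚ
  P = pPow p pr

  1<p : 1 ℕ.< p
  1<p = ℕ.nonTrivial⇒n>1 p {{prime⇒nonTrivial pr}}

  P-pos : ∀ e → 0ℚ < P e
  P-pos (+ n)    = ι-< (ℤ.+<+ (ℕP.m^n>0 p n))
  P-pos -[1+ k ] = positive⁻¹ _ {{normalize-pos 1 (p ^ suc k) {{ℕP.m^n≢0 p (suc k)}}}}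

  P-+ : ∀ m n → P (+ (m ℕ.+ n)) ≡ P (+ m) * P (+ n)
  P-+ m n = trans (cong (λ z → ι (+ z)) (ℕP.^-distribˡ-+-* p m n))
                  (trans (cong ι (ℤP.pos-* (p ^ m) (p ^ n))) (ι-* (+ (p ^ m)) (+ (p ^ n))))

  private
    shift-nonneg : ∀ e → Σ ℕ λ m → e ℤ.+ + ℤ.∣ e ∣ ≡ + m
    shift-nonneg (+ k)    = k ℕ.+ k , refl
    shift-nonneg -[1+ k ] = 0 , ℤP.n⊖n≡0 (suc k)

  P-shift : ∀ e n m → e ℤ.+ + n ≡ + m → P e * P (+ n) ≡ P (+ m)
  P-shift (+ k)    n m eq = trans (sym (P-+ k n)) (cong (λ z → P (+ z)) (ℤP.+-injective eq))
  P-shift -[1+ k ] n m eq = begin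
      P -[1+ k ] * P (+ n)                      ≡⟨ cong (λ z → P -[1+ k ] * P (+ z)) n≡m+k+1 ⟩
      P -[1+ k ] * P (+ (m ℕ.+ suc k))          ≡⟨ cong (P -[1+ k ] *_) (P-+ m (suc k)) ⟩
      P -[1+ k ] * (P (+ m) * P (+ suc k))      ≡⟨ solve 3 (λ a b c → a :* (b :* c) := b :* (a :* c)) refl (P -[1+ k ]) (P (+ m)) (P (+ suc k)) ⟩
      P (+ m) * (P -[1+ k ] * P (+ suc k))      ≡⟨ cong (P (+ m) *_) (/-*-denominator (+ 1) (p ^ suc k) {{ℕP.m^n≢0 p (suc k)}}) ⟩
      P (+ m) * 1ℚ                              ≡⟨ *-identityʳ (P (+ m)) ⟩
      P (+ m) ∎
    where
    open ≡-Reasoning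
    n≡m+k+1 : n ≡ m ℕ.+ suc k
    n≡m+k+1 = ℤP.+-injective (begin
      + n                                        ≡⟨ -i+j+i≡j (+ suc k) (+ n) ⟨
      (-[1+ k ] ℤ.+ + n) ℤ.+ + suc k             ≡⟨ cong (ℤ._+ + suc k) eq ⟩
      + (m ℕ.+ suc k) ∎)

  -- Exponent law p^(e₁+e₂) = p^e₁ · p^e₂, proved by multiplying both sides
  -- by a large enough natural power of p and cancelling.
  P-add : ∀ e₁ e₂ → P (e₁ ℤ.+ e₂) ≡ P e₁ * P e₂
  P-add e₁ e₂ = *-cancelʳ-pos (P (+ (n₁ ℕ.+ n₂))) (P-pos (+ (n₁ ℕ.+ n₂))) (begin
      P (e₁ ℤ.+ e₂) * P (+ (n₁ ℕ.+ n₂))         ≡⟨ P-shift (e₁ ℤ.+ e₂) (n₁ ℕ.+ n₂) (m₁ ℕ.+ m₂) shift₁₂ ⟩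
      P (+ (m₁ ℕ.+ m₂))                          ≡⟨ P-+ m₁ m₂ ⟩
      P (+ m₁) * P (+ m₂)                        ≡⟨ cong₂ _*_ (P-shift e₁ n₁ m₁ shift₁) (P-shift e₂ n₂ m₂ shift₂) ⟨
      (P e₁ * P (+ n₁)) * (P e₂ * P (+ n₂))      ≡⟨ solve 4 (λ a b c d → (a :* b) :* (c :* d) := (a :* c) :* (b :* d)) refl (P e₁) (P (+ n₁)) (P e₂) (P (+ n₂)) ⟩
      (P e₁ * P e₂) * (P (+ n₁) * P (+ n₂))      ≡⟨ cong ((P e₁ * P e₂) *_) (P-+ n₁ n₂) ⟨
      (P e₁ * P e₂) * P (+ (n₁ ℕ.+ n₂)) ∎)
    where
    open ≡-Reasoning
    n₁ = ℤ.∣ e₁ ∣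
    n₂ = ℤ.∣ e₂ ∣
    m₁ = proj₁ (shift-nonneg e₁)
    m₂ = proj₁ (shift-nonneg e₂)
    shift₁ = proj₂ (shift-nonneg e₁)
    shift₂ = proj₂ (shift-nonneg e₂)
    shift₁₂ : (e₁ ℤ.+ e₂) ℤ.+ + (n₁ ℕ.+ n₂) ≡ + (m₁ ℕ.+ m₂)
    shift₁₂ = trans (+-interchange e₁ e₂ (+ n₁) (+ n₂)) (cong₂ ℤ._+_ shift₁ shift₂)

  P-inverse : ∀ e → P (ℤ.- e) * P e ≡ 1ℚ
  P-inverse e = trans (sym (P-add (ℤ.- e) e)) (cong P (ℤP.+-inverseˡ e))

  P-mono-< : ∀ {e₁ e₂} → e₁ ℤ.< e₂ → P e₁ < P e₂
  P-mono-< {e₁} {e₂} e₁<e₂ with <-gap e₁<e₂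
  ... | d , refl = begin-strict
      P e₁                    ≡⟨ *-identityʳ (P e₁) ⟨
      P e₁ * 1ℚ               <⟨ *-monoʳ-<-pos (P e₁) {{positive (P-pos e₁)}} 1<p^[1+d] ⟩
      P e₁ * P (+ suc d)      ≡⟨ P-add e₁ (+ suc d) ⟨
      P (e₁ ℤ.+ + suc d) ∎
    where
    open ≤-Reasoning
    1<p^[1+d] : 1ℚ < P (+ suc d)
    1<p^[1+d] = ι-< (ℤ.+<+ (ℕP.^-monoʳ-< p 1<p {0} {suc d} (ℕ.s≤s ℕ.z≤n)))

  P-mono-≤ : ∀ {e₁ e₂} → e₁ ℤ.≤ e₂ → P e₁ ≤ P e₂
  P-mono-≤ {e₁} {e₂} e₁≤e₂ with ≤-gap e₁≤e₂
  ... | d , refl = begin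
      P e₁                    ≡⟨ *-identityʳ (P e₁) ⟨
      P e₁ * 1ℚ               ≤⟨ *-monoˡ-≤-nonNeg (P e₁) {{nonNegative (<⇒≤ (P-pos e₁))}} 1≤p^d ⟩
      P e₁ * P (+ d)          ≡⟨ P-add e₁ (+ d) ⟨
      P (e₁ ℤ.+ + d) ∎
    where
    open ≤-Reasoning
    1≤p^d : 1ℚ ≤ P (+ d)
    1≤p^d = ι-≤ (ℤ.+≤+ (ℕP.m^n>0 p d))

  P-cancel-≤ : ∀ {e₁ e₂} → P e₁ ≤ P e₂ → e₁ ℤ.≤ e₂
  P-cancel-≤ {e₁} {e₂} le with e₁ ℤ.≤? e₂
  ... | yes e₁≤e₂ = e₁≤e₂
  ... | no  e₁≰e₂ = ⊥-elim (<-irrefl refl (≤-<-trans le (P-mono-< (ℤP.≰⇒> e₁≰e₂))))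

  Z : ℚ → Set
  Z = InZ1/p p

  Z-ι : ∀ m → Z (ι m)
  Z-ι m = 0 , m , *-identityʳ (ι m)

  Z-P : ∀ e → Z (P e)
  Z-P e = ℤ.∣ e ∣ , + (p ^ proj₁ (shift-nonneg e)) ,
          P-shift e ℤ.∣ e ∣ (proj₁ (shift-nonneg e)) (proj₂ (shift-nonneg e))

  Z-neg : ∀ {x} → Z x → Z (- x)
  Z-neg {x} (n , m , eq) = n , ℤ.- m , (begin
      (- x) * P (+ n)      ≡⟨ solve 2 (λ x a → (:- x) :* a := :- (x :* a)) refl x (P (+ n)) ⟩
      - (x * P (+ n))      ≡⟨ cong -_ eq ⟩
      - ι m                ≡⟨ ι-neg m ⟨
      ι (ℤ.- m) ∎)
    where open ≡-Reasoning

  Z-+ : ∀ {x y} → Z x → Z y → Z (x + y)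
  Z-+ {x} {y} (n₁ , m₁ , eq₁) (n₂ , m₂ , eq₂) = n₁ ℕ.+ n₂ , m₁ ℤ.* + (p ^ n₂) ℤ.+ m₂ ℤ.* + (p ^ n₁) , (begin
      (x + y) * P (+ (n₁ ℕ.+ n₂))                              ≡⟨ cong ((x + y) *_) (P-+ n₁ n₂) ⟩
      (x + y) * (P (+ n₁) * P (+ n₂))                          ≡⟨ solve 4 (λ x y a b → (x :+ y) :* (a :* b) := (x :* a) :* b :+ (y :* b) :* a) refl x y (P (+ n₁)) (P (+ n₂)) ⟩
      (x * P (+ n₁)) * P (+ n₂) + (y * P (+ n₂)) * P (+ n₁)    ≡⟨ cong₂ (λ u v → u * P (+ n₂) + v * P (+ n₁)) eq₁ eq₂ ⟩
      ι m₁ * ι (+ (p ^ n₂)) + ι m₂ * ι (+ (p ^ n₁))            ≡⟨ cong₂ _+_ (ι-* m₁ _) (ι-* m₂ _) ⟨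
      ι (m₁ ℤ.* + (p ^ n₂)) + ι (m₂ ℤ.* + (p ^ n₁))            ≡⟨ ι-+ (m₁ ℤ.* + (p ^ n₂)) (m₂ ℤ.* + (p ^ n₁)) ⟨
      ι (m₁ ℤ.* + (p ^ n₂) ℤ.+ m₂ ℤ.* + (p ^ n₁)) ∎)
    where open ≡-Reasoning

  Z-- : ∀ {x y} → Z x → Z y → Z (x - y)
  Z-- {x} {y} zx zy = Z-+ {x} { - y} zx (Z-neg {y} zy)

  Z-* : ∀ {x y} → Z x → Z y → Z (x * y)
  Z-* {x} {y} (n₁ , m₁ , eq₁) (n₂ , m₂ , eq₂) = n₁ ℕ.+ n₂ , m₁ ℤ.* m₂ , (begin
      (x * y) * P (+ (n₁ ℕ.+ n₂))          ≡⟨ cong ((x * y) *_) (P-+ n₁ n₂) ⟩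
      (x * y) * (P (+ n₁) * P (+ n₂))      ≡⟨ solve 4 (λ x y a b → (x :* y) :* (a :* b) := (x :* a) :* (y :* b)) refl x y (P (+ n₁)) (P (+ n₂)) ⟩
      (x * P (+ n₁)) * (y * P (+ n₂))      ≡⟨ cong₂ _*_ eq₁ eq₂ ⟩
      ι m₁ * ι m₂                          ≡⟨ ι-* m₁ m₂ ⟨
      ι (m₁ ℤ.* m₂) ∎)
    where open ≡-Reasoning

  Z-normal-form : ∀ {x} → Z x → Σ ℤ λ m → Σ ℤ λ e → x ≡ ι m * P e
  Z-normal-form {x} (n , m , eq) = m , ℤ.- (+ n) , (begin
      x                                     ≡⟨ *-identityʳ x ⟨
      x * 1ℚ                                ≡⟨ cong (x *_) (P-inverse (+ n)) ⟨
      x * (P (ℤ.- (+ n)) * P (+ n))         ≡⟨ solve 3 (λ x a b → x :* (a :* b) := (x :* b) :* a) refl x (P (ℤ.- (+ n))) (P (+ n)) ⟩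
      (x * P (+ n)) * P (ℤ.- (+ n))         ≡⟨ cong (_* P (ℤ.- (+ n))) eq ⟩
      ι m * P (ℤ.- (+ n)) ∎)
    where open ≡-Reasoning

  p^j-coprime : ∀ {s} j → ¬ p ℕD.∣ s → ℕC.Coprime (p ^ j) s
  p^j-coprime {s} zero    p∤s = ℕC.1-coprimeTo s
  p^j-coprime {s} (suc j) p∤s {i} (i∣p*p^j , i∣s) = p^j-coprime j p∤s (i∣p^j , i∣s)
    where
    i-coprime-p : ℕC.Coprime i p
    i-coprime-p {d} (d∣i , d∣p) with prime⇒irreducible pr d∣p
    ... | inj₁ d≡1 = d≡1
    ... | inj₂ refl = ⊥-elim (p∤s (ℕD.∣-trans d∣i i∣s))
    i∣p^j : i ℕD.∣ p ^ j
    i∣p^j = ℕC.coprime-divisor i-coprime-p i∣p*p^j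

  -- Integrality: an element of Z[1/p] whose product with some s prime to p
  -- is an integer is itself an integer (p is the only denominator allowed).
  integrality : ∀ {x s u} → Z x → x * ι (+ s) ≡ ι u → ¬ p ℕD.∣ s → Σ ℤ λ c → x ≡ ι c
  integrality {x} {s} {u} (j , m , eq) xs≡u p∤s = c ,
      *-cancelʳ-pos (P (+ j)) (P-pos (+ j)) (trans eq (trans (cong ι m≡c*p^j) (ι-* c (+ (p ^ j)))))
    where
    open ≡-Reasoning
    ms≡up^j : + s ℤ.* m ≡ u ℤ.* + (p ^ j)
    ms≡up^j = trans (ℤP.*-comm (+ s) m) (ι-injective (begin
      ι (m ℤ.* + s)                  ≡⟨ ι-* m (+ s) ⟩
      ι m * ι (+ s)                  ≡⟨ cong (_* ι (+ s)) eq ⟨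
      x * P (+ j) * ι (+ s)          ≡⟨ solve 3 (λ x a b → x :* a :* b := x :* b :* a) refl x (P (+ j)) (ι (+ s)) ⟩
      x * ι (+ s) * P (+ j)          ≡⟨ cong (_* P (+ j)) xs≡u ⟩
      ι u * P (+ j)                  ≡⟨ ι-* u _ ⟨
      ι (u ℤ.* + (p ^ j)) ∎))
    p^j∣m : + (p ^ j) ℤD.∣ m
    p^j∣m = ℤD.∣ᵤ⇒∣ (ℤC.coprime-divisor (+ (p ^ j)) (+ s) m (p^j-coprime j p∤s) (ℤD.∣⇒∣ᵤ (ℤD.divides u ms≡up^j)))
    c = ℤD._∣_.quotient p^j∣m
    m≡c*p^j : m ≡ c ℤ.* + (p ^ j)
    m≡c*p^j = ℤD._∣_.equality p^j∣m

  absorb-power : ∀ s A e → ι (+ (p ^ s ℕ.* A)) * P e ≡ ι (+ A) * P (e ℤ.+ + s)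
  absorb-power s A e = begin
      ι (+ (p ^ s ℕ.* A)) * P e          ≡⟨ cong (λ z → ι z * P e) (ℤP.pos-* (p ^ s) A) ⟩
      ι (+ (p ^ s) ℤ.* + A) * P e        ≡⟨ cong (_* P e) (ι-* (+ (p ^ s)) (+ A)) ⟩
      P (+ s) * ι (+ A) * P e            ≡⟨ solve 3 (λ a b c → a :* b :* c := b :* (c :* a)) refl (P (+ s)) (ι (+ A)) (P e) ⟩
      ι (+ A) * (P e * P (+ s))          ≡⟨ cong (ι (+ A) *_) (P-add e (+ s)) ⟨
      ι (+ A) * P (e ℤ.+ + s) ∎
    where open ≡-Reasoning

  factor-out-p : ∀ M → 0 ℕ.< M → Σ ℕ λ s → Σ ℕ λ A → M ≡ p ^ s ℕ.* A × ¬ p ℕD.∣ A × 0 ℕ.< A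
  factor-out-p = <-rec _ step
    where
    step : ∀ M → (∀ {M'} → M' ℕ.< M → 0 ℕ.< M' → Σ ℕ λ s → Σ ℕ λ A → M' ≡ p ^ s ℕ.* A × ¬ p ℕD.∣ A × 0 ℕ.< A) →
           0 ℕ.< M → Σ ℕ λ s → Σ ℕ λ A → M ≡ p ^ s ℕ.* A × ¬ p ℕD.∣ A × 0 ℕ.< A
    step M rec M>0 with p ℕD.∣? M
    ... | no  p∤M = 0 , M , sym (ℕP.+-identityʳ M) , p∤M , M>0
    ... | yes (ℕD.divides M' M≡M'p) with rec M'<M M'>0
      where
      M'>0 : 0 ℕ.< M'
      M'>0 = ℕP.n≢0⇒n>0 (λ { refl → ℕP.<⇒≢ M>0 (sym M≡M'p) })
      M'<M : M' ℕ.< M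
      M'<M = subst (M' ℕ.<_) (sym M≡M'p) (ℕP.m<m*n M' p {{ℕ.>-nonZero M'>0}} 1<p)
    ... | s , A , M'≡ , p∤A , A>0 = suc s , A , M≡ , p∤A , A>0
      where
      M≡ : M ≡ p ^ suc s ℕ.* A
      M≡ = begin
        M                        ≡⟨ M≡M'p ⟩
        M' ℕ.* p                 ≡⟨ cong (ℕ._* p) M'≡ ⟩
        p ^ s ℕ.* A ℕ.* p        ≡⟨ ℕP.*-comm (p ^ s ℕ.* A) p ⟩
        p ℕ.* (p ^ s ℕ.* A)      ≡⟨ ℕP.*-assoc p (p ^ s) A ⟨
        p ^ suc s ℕ.* A ∎
        where open ≡-Reasoning

  -- A p-normal form x = t·p^σ: t a positive natural number prime to p.
  -- Its exponent determines the p-adic absolute value: |x|_p = p^(-σ).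
  record PNormal (x : ℚ) : Set where
    field
      unit     : ℕ
      exponent : ℤ
      unit>0   : 0 ℕ.< unit
      p∤unit   : ¬ p ℕD.∣ unit
      x≡       : x ≡ ι (+ unit) * P exponent

  positive-coefficient : ∀ {m} e → 0ℚ < ι m * P e → +0 ℤ.< m
  positive-coefficient {m} e 0<m*p^e = ι-<⁻ {+0} {m}
      (*-cancelʳ-<-nonNeg (P e) {{nonNegative (<⇒≤ (P-pos e))}} {0ℚ} {ι m} 0*p^e<m*p^e)
    where
    0*p^e<m*p^e : 0ℚ * P e < ι m * P e
    0*p^e<m*p^e = subst (_< ι m * P e) (sym (*-zeroˡ (P e))) 0<m*p^e

  positive-pnormal : ∀ {x} → Z x → 0ℚ < x → PNormal x
  positive-pnormal {x} zx x>0 = from-normal-form (proj₁ nf) (proj₁ (proj₂ nf)) (proj₂ (proj₂ nf))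
    where
    nf = Z-normal-form {x} zx
    from-normal-form : ∀ m e → x ≡ ι m * P e → PNormal x
    from-normal-form m e x≡m*p^e with positive-coefficient {m} e (subst (0ℚ <_) x≡m*p^e x>0)
    ... | ℤ.+<+ M>0 with factor-out-p _ M>0
    ... | s , A , M≡ , p∤A , A>0 = record
      { unit = A ; exponent = e ℤ.+ + s ; unit>0 = A>0 ; p∤unit = p∤A
      ; x≡ = trans x≡m*p^e (trans (cong (λ z → ι (+ z) * P e) M≡) (absorb-power s A e)) }

  pnormal-pos : ∀ {x} → PNormal x → 0ℚ < x
  pnormal-pos {x} N = subst₂ _<_ (*-zeroˡ (P exponent)) (sym x≡) 0*p^e<t*p^e
    where
    open PNormal N
    0*p^e<t*p^e : 0ℚ * P exponent < ι (+ unit) * P exponent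
    0*p^e<t*p^e = *-monoˡ-<-pos (P exponent) {{positive (P-pos exponent)}} {0ℚ} {ι (+ unit)} (ι-< (ℤ.+<+ unit>0))

  pnormal-*P : ∀ {x} → PNormal x → ∀ k → PNormal (x * P k)
  pnormal-*P {x} N k = record
    { unit = unit ; exponent = exponent ℤ.+ k ; unit>0 = unit>0 ; p∤unit = p∤unit
    ; x≡ = begin
        x * P k                               ≡⟨ cong (_* P k) x≡ ⟩
        ι (+ unit) * P exponent * P k         ≡⟨ *-assoc (ι (+ unit)) (P exponent) (P k) ⟩
        ι (+ unit) * (P exponent * P k)       ≡⟨ cong (ι (+ unit) *_) (P-add exponent k) ⟨
        ι (+ unit) * P (exponent ℤ.+ k) ∎ }
    where
    open PNormal N
    open ≡-Reasoning

  p∤1 : ¬ p ℕD.∣ 1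
  p∤1 p∣1 = ℕP.<⇒≢ 1<p (sym (ℕD.∣1⇒≡1 p∣1))

  pnormal-PAbs : ∀ {x} (N : PNormal x) → PAbs p pr x (P (ℤ.- PNormal.exponent N))
  pnormal-PAbs N = inj₂ (+ unit , 0 , exponent , p∤unit , p∤1 , x≡ , refl)
    where open PNormal N

  private
    lower-exponent-divides : ∀ {u v ν σ} → ν ℤ.< σ → ι u * P ν ≡ ι v * P σ → p ℕD.∣ ℤ.∣ u ∣
    lower-exponent-divides {u} {v} {ν} ν<σ eq with <-gap ν<σ
    ... | d , refl = subst (p ℕD.∣_) (sym |u|≡) (ℕD.∣-trans (ℕD.m∣m*n (p ^ d)) (ℕD.n∣m*n ℤ.∣ v ∣))
      where
      open ≡-Reasoning
      u≡ : u ≡ v ℤ.* + (p ^ suc d)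
      u≡ = ι-injective (*-cancelʳ-pos (P ν) (P-pos ν) (begin
        ι u * P ν                          ≡⟨ eq ⟩
        ι v * P (ν ℤ.+ + suc d)            ≡⟨ cong (ι v *_) (P-add ν (+ suc d)) ⟩
        ι v * (P ν * P (+ suc d))          ≡⟨ solve 3 (λ v a b → v :* (a :* b) := (v :* b) :* a) refl (ι v) (P ν) (P (+ suc d)) ⟩
        ι v * P (+ suc d) * P ν            ≡⟨ cong (_* P ν) (ι-* v (+ (p ^ suc d))) ⟨
        ι (v ℤ.* + (p ^ suc d)) * P ν ∎))
      |u|≡ : ℤ.∣ u ∣ ≡ ℤ.∣ v ∣ ℕ.* p ^ suc d
      |u|≡ = trans (cong ℤ.∣_∣ u≡) (ℤP.abs-* v (+ (p ^ suc d)))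

  exponent-unique : ∀ {u v ν σ} → ¬ p ℕD.∣ ℤ.∣ u ∣ → ¬ p ℕD.∣ ℤ.∣ v ∣ →
                    ι u * P ν ≡ ι v * P σ → ν ≡ σ
  exponent-unique {u} {v} {ν} {σ} p∤u p∤v eq with ℤP.<-cmp ν σ
  ... | tri< ν<σ _ _ = ⊥-elim (p∤u (lower-exponent-divides {u} {v} ν<σ eq))
  ... | tri≈ _ ν≡σ _ = ν≡σ
  ... | tri> _ _ σ<ν = ⊥-elim (p∤v (lower-exponent-divides {v} {u} σ<ν (sym eq)))

  fraction-exponent-unique : ∀ {u w ν t σ} → ¬ p ℕD.∣ ℤ.∣ u ∣ → ¬ p ℕD.∣ suc w → ¬ p ℕD.∣ t →
                             (u / suc w) * P ν ≡ ι (+ t) * P σ → ν ≡ σ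
  fraction-exponent-unique {u} {w} {ν} {t} {σ} p∤u p∤w p∤t eq =
      exponent-unique {u} {+ (t ℕ.* suc w)} p∤u p∤tw (begin
        ι u * P ν                            ≡⟨ cong (_* P ν) (/-*-denominator u (suc w)) ⟨
        (u / suc w) * ι (+ suc w) * P ν      ≡⟨ solve 3 (λ a b c → a :* b :* c := a :* c :* b) refl (u / suc w) (ι (+ suc w)) (P ν) ⟩
        (u / suc w) * P ν * ι (+ suc w)      ≡⟨ cong (_* ι (+ suc w)) eq ⟩
        ι (+ t) * P σ * ι (+ suc w)          ≡⟨ solve 3 (λ a b c → a :* b :* c := a :* c :* b) refl (ι (+ t)) (P σ) (ι (+ suc w)) ⟩
        ι (+ t) * ι (+ suc w) * P σ          ≡⟨ cong (_* P σ) (trans (cong ι (ℤP.pos-* t (suc w))) (ι-* (+ t) (+ suc w))) ⟨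
        ι (+ (t ℕ.* suc w)) * P σ ∎)
    where
    open ≡-Reasoning
    p∤tw : ¬ p ℕD.∣ t ℕ.* suc w
    p∤tw p∣tw = [ p∤t , p∤w ]′ (euclidsLemma t (suc w) pr p∣tw)

  multiple-PAbsLe : ∀ ρ σ {T} → PAbs p pr T (P (ℤ.- σ)) → PAbsLe p pr (ι (+ ρ) * P σ) T
  multiple-PAbsLe zero    σ |T| = 0ℚ , P (ℤ.- σ) , inj₁ (*-zeroˡ (P σ) , refl) , |T| , <⇒≤ (P-pos (ℤ.- σ))
  multiple-PAbsLe (suc ρ) σ |T| with factor-out-p (suc ρ) (ℕ.s≤s ℕ.z≤n)
  ... | s , A , ρ≡ , p∤A , _ =
      P (ℤ.- (σ ℤ.+ + s)) , P (ℤ.- σ) , inj₂ (+ A , 0 , σ ℤ.+ + s , p∤A , p∤1 , ρp^σ≡ , refl) , |T| ,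
      P-mono-≤ (ℤP.neg-mono-≤ (ℤP.i≤i+j σ (+ s)))
    where
    ρp^σ≡ : ι (+ suc ρ) * P σ ≡ ι (+ A) * P (σ ℤ.+ + s)
    ρp^σ≡ = trans (cong (λ z → ι (+ z) * P σ) ρ≡) (absorb-power s A σ)

  -- Conversely, inside Z[1/p], |r|_p ≤ |t·p^σ|_p forces r ∈ p^σ·ℤ: writing
  -- r = (u/w)·p^ν with p ∤ u w, the inequality gives σ ≤ ν, so r·p^(-σ)·w is
  -- an integer and integrality makes r·p^(-σ) an integer.
  PAbsLe⇒multiple : ∀ {r T} (N : PNormal T) → Z r → PAbsLe p pr r T →
                    Σ ℤ λ c → r ≡ ι c * P (PNormal.exponent N)
  PAbsLe⇒multiple N zr (_ , _ , _ , inj₁ (T≡0 , _) , _) =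
    ⊥-elim (<-irrefl (sym T≡0) (pnormal-pos N))
  PAbsLe⇒multiple N zr (_ , _ , inj₁ (r≡0 , _) , inj₂ _ , _) =
    + 0 , trans r≡0 (sym (*-zeroˡ (P (PNormal.exponent N))))
  PAbsLe⇒multiple {r} N zr
      (_ , _ , inj₂ (u , w , ν , p∤u , p∤w , r≡ , refl) , inj₂ (u' , w' , ν' , p∤u' , p∤w' , T≡ , refl) , p^-ν≤p^-ν') =
      c , (begin
        r                                 ≡⟨ *-identityʳ r ⟨
        r * 1ℚ                            ≡⟨ cong (r *_) (P-inverse σ) ⟨
        r * (P (ℤ.- σ) * P σ)             ≡⟨ *-assoc r (P (ℤ.- σ)) (P σ) ⟨
        r * P (ℤ.- σ) * P σ               ≡⟨ cong (_* P σ) x≡c ⟩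
        ι c * P σ ∎)
    where
    open PNormal N renaming (exponent to σ)
    open ≡-Reasoning
    ν'≡σ : ν' ≡ σ
    ν'≡σ = fraction-exponent-unique {u'} {w'} p∤u' p∤w' p∤unit (trans (sym T≡) x≡)
    σ≤ν : σ ℤ.≤ ν
    σ≤ν = ℤP.neg-cancel-≤ (P-cancel-≤ (subst (λ e → P (ℤ.- ν) ≤ P (ℤ.- e)) ν'≡σ p^-ν≤p^-ν'))
    d = proj₁ (≤-gap σ≤ν)
    ν≡σ+d = proj₂ (≤-gap σ≤ν)
    x*w≡ : r * P (ℤ.- σ) * ι (+ suc w) ≡ ι (u ℤ.* + (p ^ d))
    x*w≡ = begin
      r * P (ℤ.- σ) * ι (+ suc w)                         ≡⟨ cong (λ z → z * P (ℤ.- σ) * ι (+ suc w)) r≡ ⟩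
      (u / suc w) * P ν * P (ℤ.- σ) * ι (+ suc w)         ≡⟨ solve 4 (λ f g h i → f :* g :* h :* i := (f :* i) :* (h :* g)) refl (u / suc w) (P ν) (P (ℤ.- σ)) (ι (+ suc w)) ⟩
      ((u / suc w) * ι (+ suc w)) * (P (ℤ.- σ) * P ν)     ≡⟨ cong₂ _*_ (/-*-denominator u (suc w)) (sym (P-add (ℤ.- σ) ν)) ⟩
      ι u * P (ℤ.- σ ℤ.+ ν)                               ≡⟨ cong (λ e → ι u * P (ℤ.- σ ℤ.+ e)) ν≡σ+d ⟩
      ι u * P (ℤ.- σ ℤ.+ (σ ℤ.+ + d))                     ≡⟨ cong (λ e → ι u * P e) (-i+[i+j]≡j σ (+ d)) ⟩
      ι u * P (+ d)                                       ≡⟨ ι-* u (+ (p ^ d)) ⟨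
      ι (u ℤ.* + (p ^ d)) ∎
    x∈ℤ = integrality {r * P (ℤ.- σ)} {suc w} {u ℤ.* + (p ^ d)} (Z-* {r} {P (ℤ.- σ)} zr (Z-P (ℤ.- σ))) x*w≡ p∤w
    c = proj₁ x∈ℤ
    x≡c = proj₂ x∈ℤ

  -- For p ∤ t, every y ∈ Z[1/p] has a residue 0 ≤ ρ < t with y + ρ ∈ t·Z[1/p]:
  -- with y·p^n = m and Bézout p^n·X = 1 + t·Y, take ρ ≡ -m·X (mod t).
  residue-exists : ∀ {y} t .{{_ : ℕ.NonZero t}} → ¬ p ℕD.∣ t → Z y →
                   Σ ℕ λ ρ → Σ ℚ λ w → ρ ℕ.< t × Z w × y + ι (+ ρ) ≡ ι (+ t) * w
  residue-exists {y} t p∤t (n , m , y*p^n≡m) = ρ , w , ℤDM.n%ℕd<d N t , zw , y+ρ≡t*w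
    where
    open ≡-Reasoning
    bez = bezout (p ^ n) t (p^j-coprime n p∤t)
    X = proj₁ bez
    Y = proj₁ (proj₂ bez)
    p^n*X≡1+t*Y : + (p ^ n) ℤ.* X ≡ + 1 ℤ.+ + t ℤ.* Y
    p^n*X≡1+t*Y = proj₂ (proj₂ bez)
    N = ℤ.- (m ℤ.* X)
    ρ = N ℤDM.%ℕ t
    Q = N ℤDM./ℕ t
    w = - ι Q - y * ι Y
    zw : Z w
    zw = Z-- { - ι Q} {y * ι Y} (Z-neg {ι Q} (Z-ι Q)) (Z-* {y} {ι Y} (n , m , y*p^n≡m) (Z-ι Y))
    bezout-ℚ : P (+ n) * ι X ≡ 1ℚ + ι (+ t) * ι Y
    bezout-ℚ = begin
      P (+ n) * ι X                   ≡⟨ ι-* (+ (p ^ n)) X ⟨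
      ι (+ (p ^ n) ℤ.* X)             ≡⟨ cong ι p^n*X≡1+t*Y ⟩
      ι (+ 1 ℤ.+ + t ℤ.* Y)           ≡⟨ ι-+ (+ 1) (+ t ℤ.* Y) ⟩
      1ℚ + ι (+ t ℤ.* Y)              ≡⟨ cong (λ z → 1ℚ + z) (ι-* (+ t) Y) ⟩
      1ℚ + ι (+ t) * ι Y ∎
    division-ℚ : ι (+ ρ) + ι Q * ι (+ t) ≡ - (ι m * ι X)
    division-ℚ = begin
      ι (+ ρ) + ι Q * ι (+ t)         ≡⟨ cong (λ z → ι (+ ρ) + z) (ι-* Q (+ t)) ⟨
      ι (+ ρ) + ι (Q ℤ.* + t)         ≡⟨ ι-+ (+ ρ) (Q ℤ.* + t) ⟨
      ι (+ ρ ℤ.+ Q ℤ.* + t)           ≡⟨ cong ι (ℤDM.a≡a%ℕn+[a/ℕn]*n N t) ⟨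
      ι N                             ≡⟨ ι-neg (m ℤ.* X) ⟩
      - ι (m ℤ.* X)                   ≡⟨ cong -_ (ι-* m X) ⟩
      - (ι m * ι X) ∎
    y+ρ≡t*w : y + ι (+ ρ) ≡ ι (+ t) * w
    y+ρ≡t*w = begin
      y + ι (+ ρ)                                    ≡⟨ solve 4 (λ y r q t → y :+ r := y :+ (r :+ q :* t) :- q :* t) refl y (ι (+ ρ)) (ι Q) (ι (+ t)) ⟩
      y + (ι (+ ρ) + ι Q * ι (+ t)) - ι Q * ι (+ t)  ≡⟨ cong (λ z → y + z - ι Q * ι (+ t)) division-ℚ ⟩
      y + - (ι m * ι X) - ι Q * ι (+ t)              ≡⟨ cong (λ z → y + - (z * ι X) - ι Q * ι (+ t)) y*p^n≡m ⟨
      y + - (y * P (+ n) * ι X) - ι Q * ι (+ t)      ≡⟨ solve 5 (λ y a x q t → y :+ :- (y :* a :* x) :- q :* t := y :- y :* (a :* x) :- q :* t) refl y (P (+ n)) (ι X) (ι Q) (ι (+ t)) ⟩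
      y - y * (P (+ n) * ι X) - ι Q * ι (+ t)        ≡⟨ cong (λ z → y - y * z - ι Q * ι (+ t)) bezout-ℚ ⟩
      y - y * (1ℚ + ι (+ t) * ι Y) - ι Q * ι (+ t)   ≡⟨ solve 4 (λ y t v q → y :- y :* (con 1ℚ :+ t :* v) :- q :* t := t :* (:- q :- y :* v)) refl y (ι (+ t)) (ι Y) (ι Q) ⟩
      ι (+ t) * w ∎

  -- The residue is unique: if ρ₁ - ρ₂ = t·x with x ∈ Z[1/p] and p ∤ t, then x
  -- is an integer, and two residues below t differing by a multiple of t agree.
  residue-unique : ∀ {x ρ₁ ρ₂ t} → ¬ p ℕD.∣ t → ρ₁ ℕ.< t → ρ₂ ℕ.< t → Z x →
                   x * ι (+ t) ≡ ι (+ ρ₁ ℤ.- + ρ₂) → ρ₁ ≡ ρ₂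
  residue-unique {x} {ρ₁} {ρ₂} {t} p∤t ρ₁<t ρ₂<t zx x*t≡ρ₁-ρ₂ =
    congruent-below-equal ρ₁ ρ₂ t c ρ₁<t ρ₂<t (ι-injective (begin
      ι (+ ρ₁ ℤ.- + ρ₂)     ≡⟨ x*t≡ρ₁-ρ₂ ⟨
      x * ι (+ t)           ≡⟨ cong (_* ι (+ t)) x≡c ⟩
      ι c * ι (+ t)         ≡⟨ ι-* c (+ t) ⟨
      ι (c ℤ.* + t) ∎))
    where
    open ≡-Reasoning
    x∈ℤ = integrality {x} {t} {+ ρ₁ ℤ.- + ρ₂} zx x*t≡ρ₁-ρ₂ p∤t
    c = proj₁ x∈ℤ
    x≡c = proj₂ x∈ℤ

  -- Existence of (q, r): with a·p^k = t·p^σ in p-normal form, reduce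
  -- y = b·p^(-σ) to a residue ρ < t, y + ρ = t·w, and take
  -- r = ρ·p^σ, q = w·p^k; then a·q - r = p^σ·(t·w - ρ) = p^σ·y = b.
  division-exists : ∀ {a} k b → PNormal (a * P k) → Z b →
                    Σ ℚ λ q → Σ ℚ λ r → Z q × Z r × DivCond p pr k a b q r
  division-exists {a} k b N zb = q , r , zq , zr , b≡aq-r , 0≤r , r<ap^k , |r|≤|ap^k|
    where
    open PNormal N renaming (unit to t; exponent to σ; x≡ to ap^k≡tp^σ)
    instance t≢0 = ℕ.>-nonZero unit>0
    open ≡-Reasoning
    y = b * P (ℤ.- σ)
    residue = residue-exists {y} t p∤unit (Z-* {b} {P (ℤ.- σ)} zb (Z-P (ℤ.- σ)))
    ρ = proj₁ residue
    w = proj₁ (proj₂ residue)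
    ρ<t = proj₁ (proj₂ (proj₂ residue))
    zw = proj₁ (proj₂ (proj₂ (proj₂ residue)))
    y+ρ≡t*w : y + ι (+ ρ) ≡ ι (+ t) * w
    y+ρ≡t*w = proj₂ (proj₂ (proj₂ (proj₂ residue)))
    q = w * P k
    r = ι (+ ρ) * P σ
    zq : Z q
    zq = Z-* {w} {P k} zw (Z-P k)
    zr : Z r
    zr = Z-* {ι (+ ρ)} {P σ} (Z-ι (+ ρ)) (Z-P σ)
    b≡aq-r : b ≡ a * q - r
    b≡aq-r = sym (begin
      a * (w * P k) - ι (+ ρ) * P σ                ≡⟨ solve 5 (λ a w k ρ s → a :* (w :* k) :- ρ :* s := (a :* k) :* w :- ρ :* s) refl a w (P k) (ι (+ ρ)) (P σ) ⟩
      (a * P k) * w - ι (+ ρ) * P σ                ≡⟨ cong (λ z → z * w - ι (+ ρ) * P σ) ap^k≡tp^σ ⟩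
      (ι (+ t) * P σ) * w - ι (+ ρ) * P σ          ≡⟨ solve 4 (λ t s w ρ → (t :* s) :* w :- ρ :* s := (t :* w :- ρ) :* s) refl (ι (+ t)) (P σ) w (ι (+ ρ)) ⟩
      (ι (+ t) * w - ι (+ ρ)) * P σ                ≡⟨ cong (λ z → (z - ι (+ ρ)) * P σ) y+ρ≡t*w ⟨
      (y + ι (+ ρ) - ι (+ ρ)) * P σ                ≡⟨ solve 4 (λ b m ρ s → (b :* m :+ ρ :- ρ) :* s := b :* (m :* s)) refl b (P (ℤ.- σ)) (ι (+ ρ)) (P σ) ⟩
      b * (P (ℤ.- σ) * P σ)                        ≡⟨ cong (b *_) (P-inverse σ) ⟩
      b * 1ℚ                                       ≡⟨ *-identityʳ b ⟩
      b ∎)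
    0≤r : 0ℚ ≤ r
    0≤r = subst (_≤ r) (*-zeroˡ (P σ))
      (*-monoʳ-≤-nonNeg (P σ) {{nonNegative (<⇒≤ (P-pos σ))}} {ι +0} {ι (+ ρ)} (ι-≤ {+0} {+ ρ} (ℤ.+≤+ ℕ.z≤n)))
    r<ap^k : r < a * P k
    r<ap^k = subst (r <_) (sym ap^k≡tp^σ)
      (*-monoˡ-<-pos (P σ) {{positive (P-pos σ)}} {ι (+ ρ)} {ι (+ t)} (ι-< (ℤ.+<+ ρ<t)))
    |r|≤|ap^k| : PAbsLe p pr r (a * P k)
    |r|≤|ap^k| = multiple-PAbsLe ρ σ (pnormal-PAbs N)

  remainder-shape : ∀ {r T} (N : PNormal T) → Z r → 0ℚ ≤ r → r < T → PAbsLe p pr r T →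
                    Σ ℕ λ ρ → r ≡ ι (+ ρ) * P (PNormal.exponent N) × ρ ℕ.< PNormal.unit N
  remainder-shape {r} {T} N zr 0≤r r<T |r|≤|T| = ρ , r≡ρp^σ , ℤP.drop‿+<+ ρ<t
    where
    open PNormal N renaming (unit to t; exponent to σ; x≡ to T≡tp^σ)
    multiple = PAbsLe⇒multiple N zr |r|≤|T|
    c = proj₁ multiple
    r≡cp^σ : r ≡ ι c * P σ
    r≡cp^σ = proj₂ multiple
    0≤c : +0 ℤ.≤ c
    0≤c = ι-≤⁻ {+0} {c} (*-cancelʳ-≤-pos {ι +0} {ι c} (P σ) {{positive (P-pos σ)}}
            (subst₂ _≤_ (sym (*-zeroˡ (P σ))) r≡cp^σ 0≤r))
    ρ = ℤ.∣ c ∣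
    c≡ρ : c ≡ + ρ
    c≡ρ = sym (ℤP.0≤i⇒+∣i∣≡i 0≤c)
    r≡ρp^σ : r ≡ ι (+ ρ) * P σ
    r≡ρp^σ = trans r≡cp^σ (cong (λ z → ι z * P σ) c≡ρ)
    ρ<t : + ρ ℤ.< + t
    ρ<t = ι-<⁻ {+ ρ} {+ t} (*-cancelʳ-<-nonNeg (P σ) {{nonNegative (<⇒≤ (P-pos σ))}} {ι (+ ρ)} {ι (+ t)}
            (subst₂ _<_ r≡ρp^σ T≡tp^σ r<T))

  -- Uniqueness of (q, r): both remainders are ρᵢ·p^σ with ρᵢ < t, and
  -- a·(q₁ - q₂) = r₁ - r₂ makes (ρ₁ - ρ₂)/t = (q₁ - q₂)·p^(-k) lie in Z[1/p],
  -- so ρ₁ = ρ₂; then q₁ = q₂ because a ≠ 0.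
  division-unique : ∀ {a b k q₁ r₁ q₂ r₂} → 0ℚ < a → PNormal (a * P k) →
                    Z q₁ → Z r₁ → Z q₂ → Z r₂ →
                    DivCond p pr k a b q₁ r₁ → DivCond p pr k a b q₂ r₂ → q₁ ≡ q₂ × r₁ ≡ r₂
  division-unique {a} {b} {k} {q₁} {r₁} {q₂} {r₂} 0<a N zq₁ zr₁ zq₂ zr₂
                  (b≡aq₁-r₁ , 0≤r₁ , r₁<T , |r₁|≤|T|) (b≡aq₂-r₂ , 0≤r₂ , r₂<T , |r₂|≤|T|) = q₁≡q₂ , r₁≡r₂
    where
    open PNormal N renaming (unit to t; exponent to σ; x≡ to ap^k≡tp^σ)
    open ≡-Reasoning
    shape₁ = remainder-shape N zr₁ 0≤r₁ r₁<T |r₁|≤|T|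
    shape₂ = remainder-shape N zr₂ 0≤r₂ r₂<T |r₂|≤|T|
    ρ₁ = proj₁ shape₁
    ρ₂ = proj₁ shape₂
    r₁≡ρ₁p^σ = proj₁ (proj₂ shape₁)
    r₂≡ρ₂p^σ = proj₁ (proj₂ shape₂)
    x = (q₁ - q₂) * P (ℤ.- k)
    zx : Z x
    zx = Z-* {q₁ - q₂} {P (ℤ.- k)} (Z-- {q₁} {q₂} zq₁ zq₂) (Z-P (ℤ.- k))
    x*t*p^σ≡ : x * ι (+ t) * P σ ≡ ι (+ ρ₁ ℤ.- + ρ₂) * P σ
    x*t*p^σ≡ = begin
      x * ι (+ t) * P σ                          ≡⟨ solve 5 (λ q₁ q₂ m t s → (q₁ :- q₂) :* m :* t :* s := (q₁ :- q₂) :* m :* (t :* s)) refl q₁ q₂ (P (ℤ.- k)) (ι (+ t)) (P σ) ⟩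
      x * (ι (+ t) * P σ)                        ≡⟨ cong (x *_) ap^k≡tp^σ ⟨
      (q₁ - q₂) * P (ℤ.- k) * (a * P k)          ≡⟨ solve 5 (λ q₁ q₂ m a k → (q₁ :- q₂) :* m :* (a :* k) := a :* (q₁ :- q₂) :* (m :* k)) refl q₁ q₂ (P (ℤ.- k)) a (P k) ⟩
      a * (q₁ - q₂) * (P (ℤ.- k) * P k)          ≡⟨ cong₂ _*_ (remainder-difference {a} {b} {q₁} {r₁} {q₂} {r₂} b≡aq₁-r₁ b≡aq₂-r₂) (P-inverse k) ⟩
      (r₁ - r₂) * 1ℚ                             ≡⟨ cong₂ (λ u v → (u - v) * 1ℚ) r₁≡ρ₁p^σ r₂≡ρ₂p^σ ⟩
      (ι (+ ρ₁) * P σ - ι (+ ρ₂) * P σ) * 1ℚ     ≡⟨ solve 3 (λ u v s → (u :* s :- v :* s) :* con 1ℚ := (u :+ :- v) :* s) refl (ι (+ ρ₁)) (ι (+ ρ₂)) (P σ) ⟩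
      (ι (+ ρ₁) + - ι (+ ρ₂)) * P σ              ≡⟨ cong (λ z → (ι (+ ρ₁) + z) * P σ) (ι-neg (+ ρ₂)) ⟨
      (ι (+ ρ₁) + ι (ℤ.- + ρ₂)) * P σ            ≡⟨ cong (_* P σ) (ι-+ (+ ρ₁) (ℤ.- + ρ₂)) ⟨
      ι (+ ρ₁ ℤ.- + ρ₂) * P σ ∎
    ρ₁≡ρ₂ : ρ₁ ≡ ρ₂
    ρ₁≡ρ₂ = residue-unique {x} {ρ₁} {ρ₂} {t} p∤unit (proj₂ (proj₂ shape₁)) (proj₂ (proj₂ shape₂)) zx
              (*-cancelʳ-pos {x * ι (+ t)} {ι (+ ρ₁ ℤ.- + ρ₂)} (P σ) (P-pos σ) x*t*p^σ≡)
    r₁≡r₂ : r₁ ≡ r₂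
    r₁≡r₂ = trans r₁≡ρ₁p^σ (trans (cong (λ z → ι (+ z) * P σ) ρ₁≡ρ₂) (sym r₂≡ρ₂p^σ))
    q₁≡q₂ : q₁ ≡ q₂
    q₁≡q₂ = quotient-determined {a} {b} {q₁} {r₁} {q₂} {r₂} 0<a b≡aq₁-r₁ b≡aq₂-r₂ r₁≡r₂

theorem4p1 : (p : ℕ) (pr : Prime p) (k : ℤ) (a b : ℚ) →
    InZ1/p p a → InZ1/p p b → 0ℚ < a →
    Σ ℚ λ q → Σ ℚ λ r →
    (InZ1/p p q × InZ1/p p r × DivCond p pr k a b q r)
    × ((q' r' : ℚ) → InZ1/p p q' → InZ1/p p r' → DivCond p pr k a b q' r' →
    q' ≡ q × r' ≡ r)
theorem4p1 p pr k a b za zb 0<a = q , r , (zq , zr , q,r-divide) , unique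
  where
  T-normal : PNormal p pr (a * pPow p pr k)
  T-normal = pnormal-*P p pr {a} (positive-pnormal p pr {a} za 0<a) k
  solution = division-exists p pr {a} k b T-normal zb
  q = proj₁ solution
  r = proj₁ (proj₂ solution)
  zq = proj₁ (proj₂ (proj₂ solution))
  zr = proj₁ (proj₂ (proj₂ (proj₂ solution)))
  q,r-divide = proj₂ (proj₂ (proj₂ (proj₂ solution)))
  unique : (q' r' : ℚ) → InZ1/p p q' → InZ1/p p r' → DivCond p pr k a b q' r' → q' ≡ q × r' ≡ r
  unique q' r' zq' zr' q',r'-divide =
    division-unique p pr {a} {b} {k} {q'} {r'} {q} {r} 0<a T-normal zq' zr' zq zr q',r'-divide q,r-divide
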